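{- Let $n$ be a positive multiple of four, and let $\Omega_n$ be the graph whose vertices are the subsets of $[n]=\{1,\dots,n\}$, two subsets being adjacent if and only if their symmetric difference has size exactly $n/2$. Then \[ \alpha(\Omega_n)\leq \frac{2^n}{n}. \] Furthermore, if equality holds, then the characteristic vector (indexed by subsets of $[n]$) of any maximum independent set lies in the column space of the matrix $\widetilde W=\begin{pmatrix}W & \mathbf{1}\end{pmatrix}$, where $W$ is the matrix with rows indexed by all subsets of $[n]$ and columns indexed by all $2$-subsets and all $(n-2)$-subsets of $[n]$, whose $(A,p)$-entry is $(-1)^{|A\cap p|}$, and $\mathbf{1}$ is the all-ones column vector.
   Context: Identifying a subset of $[n]$ with the $\pm1$-vector having $-1$ exactly in the positions of the subset, $\Omega_n$ is the graph on $\pm1$-vectors of length $n$ with adjacency given by orthogonality. $\alpha$ denotes the independence number. -}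

module Defs where

open import Data.Bool using (Bool; true; false; if_then_else_)
open import Data.Nat using (ℕ; zero; suc; _+_; _*_)
open import Data.List using (List; []; _∷_; map; _++_; filter; length; foldr)
open import Data.Vec using (Vec)
open import Data.Fin.Subset using (Subset; _∩_; _∪_; _─_; ∣_∣)
open import Data.Rational using (ℚ; 0ℚ; 1ℚ; -_)
import Data.Rational as Q
open import Data.Product using (Σ; _×_)
open import Data.Sum using (_⊎_)
open import Relation.Binary.PropositionalEquality using (_≡_)
open import Relation.Nullary using (¬_)
open import Relation.Nullary.Decidable using (does)
open import Data.Bool using (T)

allSubsets : (n : ℕ) → List (Subset n)
allSubsets zero = Data.Vec.[] ∷ []
allSubsets (suc n) = map (false Data.Vec.∷_) (allSubsets n) ++ map (true Data.Vec.∷_) (allSubsets n)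

_△_ : {n : ℕ} → Subset n → Subset n → Subset n
p △ q = (p ─ q) ∪ (q ─ p)

-- Ω_n adjacency (for n = 4(k+1), n/2 = 2(k+1)): |A △ B| = n/2
Adjacent : (k : ℕ) → Subset (4 * suc k) → Subset (4 * suc k) → Set
Adjacent k A B = ∣ A △ B ∣ ≡ 2 * suc k

-- A vertex set of Ω_n given by its indicator function I
IsIndependent : (k : ℕ) → (Subset (4 * suc k) → Bool) → Set
IsIndependent k I = ∀ A B → I A ≡ true → I B ≡ true → ¬ Adjacent k A B

size : {n : ℕ} → (Subset n → Bool) → ℕ
size {n} I = length (filter (λ A → Data.Bool._≟_ (I A) true) (allSubsets n))

sumℚ : List ℚ → ℚ
sumℚ = foldr Q._+_ 0ℚ

sign : ℕ → ℚ
sign zero = 1ℚ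
sign (suc m) = - sign m

χ : {n : ℕ} → (Subset n → Bool) → Subset n → ℚ
χ I A = if I A then 1ℚ else 0ℚ

IsColumn : (k : ℕ) → Subset (4 * suc k) → Set
IsColumn k p = (∣ p ∣ ≡ 2) ⊎ (2 + ∣ p ∣ ≡ 4 * suc k)

-- v lies in the column space of W~ = (W 1): v = W c + c₀ 1,
-- i.e. v(A) = Σ_{p column} c(p) (-1)^{|A ∩ p|} + c₀ for all A.
-- Coefficient c is given on all subsets; only column subsets contribute.
InColSpaceW̃ : (k : ℕ) → (Subset (4 * suc k) → ℚ) → Set
InColSpaceW̃ k v =
  Σ (Subset (4 * suc k) → ℚ) λ c → Σ ℚ λ c₀ →
    ∀ A → v A ≡ sumℚ (map (λ p → if does (isColumn? p) then c p Q.* sign ∣ A ∩ p ∣ else 0ℚ)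
                              (allSubsets (4 * suc k))) Q.+ c₀
  where
  open import Data.Nat using (_≟_)
  open import Relation.Nullary.Decidable using (_⊎-dec_)
  isColumn? : (p : Subset (4 * suc k)) → Relation.Nullary.Dec (IsColumn k p)
  isColumn? p = (∣ p ∣ ≟ 2) ⊎-dec (2 + ∣ p ∣ ≟ 4 * suc k)

{-# OPTIONS --safe #-}
module Submission where

-- Write f for the indicator of an independent set I of Ω_n and f̂(S) = Σ_A f(A) (-1)^|A ∩ S| for its
-- Walsh–Fourier transform. The Fourier transform of the sphere {A : |A| = n/2} is the Krawtchouk number
-- K(S) = K_{n/2}(|S|), and independence of I says Σ_S K(S) f̂(S)² = 0. Put D = C(n, n/2) = K(∅) and
-- w(S) = (n - 1) K(S) + D. When 4 ∣ n, K vanishes at odd |S|, K is symmetric under |S| ↦ n - |S|, and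
-- |K_{n/2}(2i)| decreases from i = 0 towards the middle (consecutive values have ratio (2i + 1)/(n - 2i - 1)),
-- with (n - 1) |K_{n/2}(2)| = D; hence w ≥ 0, with w(S) = 0 only for |S| ∈ {2, n - 2}. By Parseval,
--   n D |I|² = w(∅) f̂(∅)² ≤ Σ_S w(S) f̂(S)² = D 2^n |I|,
-- that is n |I| ≤ 2^n. At equality every term with S ≠ ∅ vanishes, so f̂ is supported on ∅ and the 2- and
-- (n - 2)-subsets, and Fourier inversion expresses f in the column space of W̃.

open import Defs
open import Function using (_∘_; id)
import Data.Bool as Bool
open import Data.Bool using (Bool; true; false; if_then_else_)
open import Data.Nat as ℕ using (ℕ; zero; suc; z≤n; s≤s)
import Data.Nat.Properties as ℕₚ
open import Data.Nat.Tactic.RingSolver using () renaming (solve-∀ to ℕ-solve-∀)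
open import Data.Integer using (ℤ; +_; -[1+_]; _+_; _*_; -_; _-_; 0ℤ; 1ℤ; _≤_; _<_; +≤+; +<+)
import Data.Integer as ℤ
import Data.Integer.Properties as ℤₚ
open import Data.Integer.Tactic.RingSolver using (solve-∀)
open import Algebra.Properties.AbelianGroup ℤₚ.+-0-abelianGroup using (inverseˡ-unique)
open import Algebra.Properties.CommutativeSemigroup ℤₚ.+-commutativeSemigroup
  using () renaming (interchange to +-interchange)
open import Algebra.Properties.CommutativeSemigroup ℤₚ.*-commutativeSemigroup
  using (x∙yz≈y∙xz) renaming (interchange to *-interchange)
open import Data.Rational using (0ℚ; 1ℚ)
import Data.Rational as ℚ
import Data.Rational.Properties as ℚₚ
open import Data.Rational.Literals using (fromℤ)
import Data.Rational.Unnormalised as ℚᵘ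
import Data.Rational.Unnormalised.Properties as ℚᵘₚ
open import Data.List using (List; []; _∷_; map; filter; length; foldr; _++_)
import Data.List.Properties as List
open import Data.Vec using ([]; _∷_)
open import Data.Vec.Properties using (≡-dec)
open import Data.Fin.Subset using (Subset; _∩_; ∣_∣; ⊥; ∁)
open import Data.Fin.Subset.Properties using (∣⊥∣≡0; ∩-zeroʳ; ∣p∣≤n; ∣∁p∣≡n∸∣p∣)
open import Data.Product using (_×_; _,_; proj₁; proj₂; map₂)
open import Data.Sum using (_⊎_; inj₁; inj₂)
import Data.Sum as Sum
open import Data.Empty using (⊥-elim)
open import Relation.Nullary using (¬_; Dec; yes; no)
open import Relation.Nullary.Decidable using (does; dec-false; _⊎-dec_)
open import Relation.Binary.Definitions using (DecidableEquality; tri<; tri≈; tri>)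
open import Relation.Binary.PropositionalEquality
  using (_≡_; refl; sym; trans; cong; cong₂; subst; module ≡-Reasoning)

-- Sums over the subsets of [n]

∑ : ∀ n → (Subset n → ℤ) → ℤ
∑ zero    f = f []
∑ (suc n) f = ∑ n (f ∘ (false ∷_)) + ∑ n (f ∘ (true ∷_))

syntax ∑ n (λ A → e) = ∑[ A ⊆ n ] e

∑-cong : ∀ {n} {f g : Subset n → ℤ} → (∀ A → f A ≡ g A) → ∑ n f ≡ ∑ n g
∑-cong {zero}  f≗g = f≗g []
∑-cong {suc n} f≗g = cong₂ _+_ (∑-cong (f≗g ∘ (false ∷_))) (∑-cong (f≗g ∘ (true ∷_)))

∑-+ : ∀ {n} (f g : Subset n → ℤ) → ∑[ A ⊆ n ] (f A + g A) ≡ ∑ n f + ∑ n g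
∑-+ {zero}  f g = refl
∑-+ {suc n} f g = begin
  ∑ n (λ A → f₀ A + g₀ A) + ∑ n (λ A → f₁ A + g₁ A)  ≡⟨ cong₂ _+_ (∑-+ f₀ g₀) (∑-+ f₁ g₁) ⟩
  (∑ n f₀ + ∑ n g₀) + (∑ n f₁ + ∑ n g₁)              ≡⟨ +-interchange (∑ n f₀) (∑ n g₀) (∑ n f₁) (∑ n g₁) ⟩
  (∑ n f₀ + ∑ n f₁) + (∑ n g₀ + ∑ n g₁)              ∎
  where
  open ≡-Reasoning
  f₀ f₁ g₀ g₁ : Subset n → ℤ
  f₀ = f ∘ (false ∷_)
  f₁ = f ∘ (true ∷_)
  g₀ = g ∘ (false ∷_)
  g₁ = g ∘ (true ∷_)

∑-*ˡ : ∀ {n} c (f : Subset n → ℤ) → ∑[ A ⊆ n ] (c * f A) ≡ c * ∑ n f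
∑-*ˡ {zero}  c f = refl
∑-*ˡ {suc n} c f =
  trans (cong₂ _+_ (∑-*ˡ c (f ∘ (false ∷_))) (∑-*ˡ c (f ∘ (true ∷_)))) (sym (ℤₚ.*-distribˡ-+ c _ _))

∑-*ʳ : ∀ {n} c (f : Subset n → ℤ) → ∑[ A ⊆ n ] (f A * c) ≡ ∑ n f * c
∑-*ʳ c f = trans (∑-cong (λ A → ℤₚ.*-comm (f A) c)) (trans (∑-*ˡ c f) (ℤₚ.*-comm c _))

∑-neg : ∀ {n} (f : Subset n → ℤ) → ∑[ A ⊆ n ] (- f A) ≡ - ∑ n f
∑-neg f = trans (∑-cong (λ A → sym (ℤₚ.-1*i≡-i (f A)))) (trans (∑-*ˡ (- 1ℤ) f) (ℤₚ.-1*i≡-i _))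

∑-zero : ∀ {n} {f : Subset n → ℤ} → (∀ A → f A ≡ 0ℤ) → ∑ n f ≡ 0ℤ
∑-zero {zero}  f≗0 = f≗0 []
∑-zero {suc n} f≗0 = cong₂ _+_ (∑-zero (f≗0 ∘ (false ∷_))) (∑-zero (f≗0 ∘ (true ∷_)))

∑-swap : ∀ {m n} (f : Subset m → Subset n → ℤ) →
         ∑[ A ⊆ m ] ∑[ B ⊆ n ] f A B ≡ ∑[ B ⊆ n ] ∑[ A ⊆ m ] f A B
∑-swap {zero}  f = refl
∑-swap {suc m} f = trans (cong₂ _+_ (∑-swap (f ∘ (false ∷_))) (∑-swap (f ∘ (true ∷_))))
                         (sym (∑-+ (λ B → ∑ m (λ A → f (false ∷ A) B)) (λ B → ∑ m (λ A → f (true ∷ A) B))))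

∑-nonneg : ∀ {n} {f : Subset n → ℤ} → (∀ A → 0ℤ ≤ f A) → 0ℤ ≤ ∑ n f
∑-nonneg {zero}  f≥0 = f≥0 []
∑-nonneg {suc n} f≥0 = ℤₚ.+-mono-≤ (∑-nonneg (f≥0 ∘ (false ∷_))) (∑-nonneg (f≥0 ∘ (true ∷_)))

+-nonneg-≡0 : ∀ {a b} → 0ℤ ≤ a → 0ℤ ≤ b → a + b ≡ 0ℤ → a ≡ 0ℤ × b ≡ 0ℤ
+-nonneg-≡0 {a} {b} a≥0 b≥0 a+b≡0 = a≡0 , trans (sym (ℤₚ.+-identityˡ b)) (trans (cong (_+ b) (sym a≡0)) a+b≡0)
  where
  a≡0 : a ≡ 0ℤ
  a≡0 = ℤₚ.≤-antisym (subst (a ≤_) a+b≡0 (ℤₚ.i≤i+j a b {{ℤ.nonNegative b≥0}})) a≥0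

∑-nonneg-≡0 : ∀ {n} {f : Subset n → ℤ} → (∀ A → 0ℤ ≤ f A) → ∑ n f ≡ 0ℤ → ∀ A → f A ≡ 0ℤ
∑-nonneg-≡0 {zero}  f≥0 ∑≡0 [] = ∑≡0
∑-nonneg-≡0 {suc n} f≥0 ∑≡0 (b ∷ A)
  with +-nonneg-≡0 (∑-nonneg (f≥0 ∘ (false ∷_))) (∑-nonneg (f≥0 ∘ (true ∷_))) ∑≡0 | b
... | ∑₀≡0 , _    | false = ∑-nonneg-≡0 (f≥0 ∘ (false ∷_)) ∑₀≡0 A
... | _    , ∑₁≡0 | true  = ∑-nonneg-≡0 (f≥0 ∘ (true ∷_)) ∑₁≡0 A

infix 4 _≟ₛ_
_≟ₛ_ : ∀ {n} → DecidableEquality (Subset n)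
_≟ₛ_ = ≡-dec Bool._≟_

∑-delta : ∀ {n} (g : Subset n → ℤ) C → ∑[ A ⊆ n ] (if does (A ≟ₛ C) then g A else 0ℤ) ≡ g C
∑-delta {zero}  g [] = refl
∑-delta {suc n} g (false ∷ C) =
  trans (cong₂ _+_ (∑-delta (g ∘ (false ∷_)) C) (∑-zero {n} (λ _ → refl))) (ℤₚ.+-identityʳ _)
∑-delta {suc n} g (true ∷ C) =
  trans (cong₂ _+_ (∑-zero {n} (λ _ → refl)) (∑-delta (g ∘ (true ∷_)) C)) (ℤₚ.+-identityˡ _)

∑-split-⊥ : ∀ {n} (f : Subset n → ℤ) → ∑ n f ≡ f ⊥ + ∑[ S ⊆ n ] (if does (S ≟ₛ ⊥) then 0ℤ else f S)
∑-split-⊥ {n} f = begin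
  ∑ n f                                  ≡⟨ ∑-cong (λ S → split (does (S ≟ₛ ⊥)) (f S)) ⟩
  ∑[ S ⊆ n ] (on⊥ S + off⊥ S)            ≡⟨ ∑-+ on⊥ off⊥ ⟩
  ∑ n on⊥ + ∑ n off⊥                     ≡⟨ cong (_+ ∑ n off⊥) (∑-delta f ⊥) ⟩
  f ⊥ + ∑ n off⊥                         ∎
  where
  open ≡-Reasoning
  on⊥ off⊥ : Subset n → ℤ
  on⊥  S = if does (S ≟ₛ ⊥) then f S else 0ℤ
  off⊥ S = if does (S ≟ₛ ⊥) then 0ℤ else f S
  split : ∀ b x → x ≡ (if b then x else 0ℤ) + (if b then 0ℤ else x)
  split true  x = sym (ℤₚ.+-identityʳ x)
  split false x = sym (ℤₚ.+-identityˡ x)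

-- Walsh characters and the Fourier transform

neg*neg : ∀ x y → (- x) * (- y) ≡ x * y
neg*neg = solve-∀

signℤ : ℕ → ℤ
signℤ zero    = 1ℤ
signℤ (suc m) = - signℤ m

signℤ-+ : ∀ a b → signℤ (a ℕ.+ b) ≡ signℤ a * signℤ b
signℤ-+ zero    b = sym (ℤₚ.*-identityˡ (signℤ b))
signℤ-+ (suc a) b = trans (cong -_ (signℤ-+ a b)) (ℤₚ.neg-distribˡ-* (signℤ a) (signℤ b))

signℤ-even : ∀ a → signℤ (a ℕ.+ a) ≡ 1ℤ
signℤ-even a = trans (signℤ-+ a a) (square a)
  where
  square : ∀ a → signℤ a * signℤ a ≡ 1ℤ
  square zero    = refl
  square (suc a) = trans (neg*neg (signℤ a) (signℤ a)) (square a)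

walsh : ∀ {n} → Subset n → Subset n → ℤ
walsh A S = signℤ ∣ A ∩ S ∣

walsh-⊥ : ∀ {n} (A : Subset n) → walsh A ⊥ ≡ 1ℤ
walsh-⊥ {n} A = trans (cong (signℤ ∘ ∣_∣) (∩-zeroʳ A)) (cong signℤ (∣⊥∣≡0 n))

walsh-△ : ∀ {n} (A B S : Subset n) → walsh A S * walsh B S ≡ walsh (A △ B) S
walsh-△ [] [] [] = refl
walsh-△ (false ∷ A) (false ∷ B) (s ∷ S)     = walsh-△ A B S
walsh-△ (true  ∷ A) (true  ∷ B) (false ∷ S) = walsh-△ A B S
walsh-△ (true  ∷ A) (true  ∷ B) (true  ∷ S) =
  trans (neg*neg (walsh A S) (walsh B S)) (walsh-△ A B S)
walsh-△ (false ∷ A) (true  ∷ B) (false ∷ S) = walsh-△ A B S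
walsh-△ (false ∷ A) (true  ∷ B) (true  ∷ S) =
  trans (sym (ℤₚ.neg-distribʳ-* (walsh A S) (walsh B S))) (cong -_ (walsh-△ A B S))
walsh-△ (true  ∷ A) (false ∷ B) (false ∷ S) = walsh-△ A B S
walsh-△ (true  ∷ A) (false ∷ B) (true  ∷ S) =
  trans (sym (ℤₚ.neg-distribˡ-* (walsh A S) (walsh B S))) (cong -_ (walsh-△ A B S))

private
  doubling : ∀ {n} b → (if b then + 2 ℕ.^ n else 0ℤ) + (if b then + 2 ℕ.^ n else 0ℤ)
                       ≡ (if b then + 2 ℕ.^ suc n else 0ℤ)
  doubling {n} true  = trans (sym (ℤₚ.pos-+ (2 ℕ.^ n) _)) (cong (λ x → + (2 ℕ.^ n ℕ.+ x)) (sym (ℕₚ.+-identityʳ _)))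
  doubling     false = refl

walsh-orthogonal : ∀ {n} (A C : Subset n) →
                   ∑[ S ⊆ n ] (walsh A S * walsh C S) ≡ (if does (A ≟ₛ C) then + 2 ℕ.^ n else 0ℤ)
walsh-orthogonal [] [] = refl
walsh-orthogonal {suc n} (false ∷ A) (false ∷ C) =
  trans (cong₂ _+_ (walsh-orthogonal A C) (walsh-orthogonal A C)) (doubling {n} (does (A ≟ₛ C)))
walsh-orthogonal {suc n} (true ∷ A) (true ∷ C) =
  trans (cong₂ _+_ (walsh-orthogonal A C)
                   (trans (∑-cong (λ S → neg*neg (walsh A S) (walsh C S))) (walsh-orthogonal A C)))
        (doubling {n} (does (A ≟ₛ C)))
walsh-orthogonal {suc n} (false ∷ A) (true ∷ C) =
  trans (cong (_+_ (∑ n ψ))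
              (trans (∑-cong (λ S → sym (ℤₚ.neg-distribʳ-* (walsh A S) (walsh C S)))) (∑-neg ψ)))
        (ℤₚ.+-inverseʳ (∑ n ψ))
  where ψ = λ S → walsh A S * walsh C S
walsh-orthogonal {suc n} (true ∷ A) (false ∷ C) =
  trans (cong (_+_ (∑ n ψ))
              (trans (∑-cong (λ S → sym (ℤₚ.neg-distribˡ-* (walsh A S) (walsh C S)))) (∑-neg ψ)))
        (ℤₚ.+-inverseʳ (∑ n ψ))
  where ψ = λ S → walsh A S * walsh C S

fourier : ∀ {n} → (Subset n → ℤ) → Subset n → ℤ
fourier {n} f S = ∑[ A ⊆ n ] (f A * walsh A S)

fourier-⊥ : ∀ {n} (f : Subset n → ℤ) → fourier f ⊥ ≡ ∑ n f
fourier-⊥ f = ∑-cong (λ A → trans (cong (f A *_) (walsh-⊥ A)) (ℤₚ.*-identityʳ (f A)))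

fourier-inversion : ∀ {n} (f : Subset n → ℤ) C → ∑[ S ⊆ n ] (fourier f S * walsh C S) ≡ + 2 ℕ.^ n * f C
fourier-inversion {n} f C = begin
  ∑[ S ⊆ n ] (fourier f S * walsh C S)
    ≡⟨ ∑-cong (λ S → sym (∑-*ʳ (walsh C S) (λ A → f A * walsh A S))) ⟩
  ∑[ S ⊆ n ] ∑[ A ⊆ n ] (f A * walsh A S * walsh C S)
    ≡⟨ ∑-swap (λ S A → f A * walsh A S * walsh C S) ⟩
  ∑[ A ⊆ n ] ∑[ S ⊆ n ] (f A * walsh A S * walsh C S)
    ≡⟨ ∑-cong (λ A → trans (∑-cong (λ S → ℤₚ.*-assoc (f A) (walsh A S) (walsh C S)))
                           (∑-*ˡ (f A) (λ S → walsh A S * walsh C S))) ⟩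
  ∑[ A ⊆ n ] (f A * ∑[ S ⊆ n ] (walsh A S * walsh C S))
    ≡⟨ ∑-cong (λ A → trans (cong (f A *_) (walsh-orthogonal A C)) (pull (does (A ≟ₛ C)) (f A))) ⟩
  ∑[ A ⊆ n ] (if does (A ≟ₛ C) then + 2 ℕ.^ n * f A else 0ℤ)
    ≡⟨ ∑-delta (λ A → + 2 ℕ.^ n * f A) C ⟩
  + 2 ℕ.^ n * f C ∎
  where
  open ≡-Reasoning
  pull : ∀ b x → x * (if b then + 2 ℕ.^ n else 0ℤ) ≡ (if b then + 2 ℕ.^ n * x else 0ℤ)
  pull true  x = ℤₚ.*-comm x _
  pull false x = ℤₚ.*-zeroʳ x

fourier-square : ∀ {n} (f : Subset n → ℤ) S →
                 fourier f S * fourier f S ≡ ∑[ A ⊆ n ] ∑[ B ⊆ n ] (f A * f B * walsh (A △ B) S)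
fourier-square {n} f S = begin
  fourier f S * fourier f S
    ≡⟨ sym (∑-*ʳ (fourier f S) (λ A → f A * walsh A S)) ⟩
  ∑[ A ⊆ n ] (f A * walsh A S * fourier f S)
    ≡⟨ ∑-cong (λ A → sym (∑-*ˡ (f A * walsh A S) (λ B → f B * walsh B S))) ⟩
  ∑[ A ⊆ n ] ∑[ B ⊆ n ] (f A * walsh A S * (f B * walsh B S))
    ≡⟨ ∑-cong (λ A → ∑-cong (λ B → *-interchange (f A) (walsh A S) (f B) (walsh B S))) ⟩
  ∑[ A ⊆ n ] ∑[ B ⊆ n ] (f A * f B * (walsh A S * walsh B S))
    ≡⟨ ∑-cong (λ A → ∑-cong (λ B → cong (f A * f B *_) (walsh-△ A B S))) ⟩
  ∑[ A ⊆ n ] ∑[ B ⊆ n ] (f A * f B * walsh (A △ B) S) ∎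
  where open ≡-Reasoning

fourier-quadratic-form : ∀ {n} (e f : Subset n → ℤ) →
  ∑[ S ⊆ n ] (fourier e S * (fourier f S * fourier f S)) ≡ + 2 ℕ.^ n * ∑[ A ⊆ n ] ∑[ B ⊆ n ] (f A * f B * e (A △ B))
fourier-quadratic-form {n} e f = begin
  ∑[ S ⊆ n ] (fourier e S * (fourier f S * fourier f S))
    ≡⟨ ∑-cong (λ S → trans (cong (fourier e S *_) (fourier-square f S))
                           (trans (sym (∑-*ˡ (fourier e S) (λ A → ∑[ B ⊆ n ] (f A * f B * walsh (A △ B) S))))
                                  (∑-cong (λ A → sym (∑-*ˡ (fourier e S) (λ B → f A * f B * walsh (A △ B) S)))))) ⟩
  ∑[ S ⊆ n ] ∑[ A ⊆ n ] ∑[ B ⊆ n ] (fourier e S * (f A * f B * walsh (A △ B) S))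
    ≡⟨ trans (∑-swap (λ S A → ∑[ B ⊆ n ] (fourier e S * (f A * f B * walsh (A △ B) S))))
             (∑-cong (λ A → ∑-swap (λ S B → fourier e S * (f A * f B * walsh (A △ B) S)))) ⟩
  ∑[ A ⊆ n ] ∑[ B ⊆ n ] ∑[ S ⊆ n ] (fourier e S * (f A * f B * walsh (A △ B) S))
    ≡⟨ ∑-cong (λ A → ∑-cong (λ B → trans (∑-cong (λ S → x∙yz≈y∙xz (fourier e S) (f A * f B) (walsh (A △ B) S)))
                                          (∑-*ˡ (f A * f B) (λ S → fourier e S * walsh (A △ B) S)))) ⟩
  ∑[ A ⊆ n ] ∑[ B ⊆ n ] (f A * f B * ∑[ S ⊆ n ] (fourier e S * walsh (A △ B) S))
    ≡⟨ ∑-cong (λ A → ∑-cong (λ B → cong (f A * f B *_) (fourier-inversion e (A △ B)))) ⟩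
  ∑[ A ⊆ n ] ∑[ B ⊆ n ] (f A * f B * (+ 2 ℕ.^ n * e (A △ B)))
    ≡⟨ ∑-cong (λ A → trans (∑-cong (λ B → x∙yz≈y∙xz (f A * f B) (+ 2 ℕ.^ n) (e (A △ B))))
                           (∑-*ˡ (+ 2 ℕ.^ n) (λ B → f A * f B * e (A △ B)))) ⟩
  ∑[ A ⊆ n ] (+ 2 ℕ.^ n * ∑[ B ⊆ n ] (f A * f B * e (A △ B)))
    ≡⟨ ∑-*ˡ (+ 2 ℕ.^ n) (λ A → ∑[ B ⊆ n ] (f A * f B * e (A △ B))) ⟩
  + 2 ℕ.^ n * ∑[ A ⊆ n ] ∑[ B ⊆ n ] (f A * f B * e (A △ B)) ∎
  where open ≡-Reasoning

parseval : ∀ {n} (f : Subset n → ℤ) → ∑[ S ⊆ n ] (fourier f S * fourier f S) ≡ + 2 ℕ.^ n * ∑[ A ⊆ n ] (f A * f A)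
parseval {n} f = begin
  ∑[ S ⊆ n ] (fourier f S * fourier f S)
    ≡⟨ ∑-cong (λ S → sym (∑-*ˡ (fourier f S) (λ A → f A * walsh A S))) ⟩
  ∑[ S ⊆ n ] ∑[ A ⊆ n ] (fourier f S * (f A * walsh A S))
    ≡⟨ ∑-swap (λ S A → fourier f S * (f A * walsh A S)) ⟩
  ∑[ A ⊆ n ] ∑[ S ⊆ n ] (fourier f S * (f A * walsh A S))
    ≡⟨ ∑-cong (λ A → trans (∑-cong (λ S → x∙yz≈y∙xz (fourier f S) (f A) (walsh A S)))
                           (∑-*ˡ (f A) (λ S → fourier f S * walsh A S))) ⟩
  ∑[ A ⊆ n ] (f A * ∑[ S ⊆ n ] (fourier f S * walsh A S))
    ≡⟨ ∑-cong (λ A → trans (cong (f A *_) (fourier-inversion f A)) (x∙yz≈y∙xz (f A) (+ 2 ℕ.^ n) (f A))) ⟩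
  ∑[ A ⊆ n ] (+ 2 ℕ.^ n * (f A * f A))
    ≡⟨ ∑-*ˡ (+ 2 ℕ.^ n) (λ A → f A * f A) ⟩
  + 2 ℕ.^ n * ∑[ A ⊆ n ] (f A * f A) ∎
  where open ≡-Reasoning

-- Krawtchouk numbers

-- K a b m is the coefficient of x^m in (1 - x)^a (1 + x)^b, i.e. the Krawtchouk number K_m(a) in length
-- a + b. The degree m ranges over ℤ (K vanishes for m < 0), so the Pascal-type recurrences need no case
-- split at m = 0.
K : ℕ → ℕ → ℤ → ℤ
K zero    zero    (+ zero) = 1ℤ
K zero    zero    _        = 0ℤ
K zero    (suc b) m        = K 0 b m + K 0 b (m - 1ℤ)
K (suc a) b       m        = K a b m - K a b (m - 1ℤ)

K-negative : ∀ a b x → K a b -[1+ x ] ≡ 0ℤ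
K-negative zero    zero    x = refl
K-negative zero    (suc b) x = cong₂ _+_ (K-negative 0 b x) (K-negative 0 b _)
K-negative (suc a) b       x = cong₂ _-_ (K-negative a b x) (K-negative a b _)

K-sucʳ : ∀ a b m → K a (suc b) m ≡ K a b m + K a b (m - 1ℤ)
K-sucʳ zero    b m = refl
K-sucʳ (suc a) b m = trans (cong₂ _-_ (K-sucʳ a b m) (K-sucʳ a b (m - 1ℤ)))
                           (regroup (K a b m) (K a b (m - 1ℤ)) (K a b (m - 1ℤ - 1ℤ)))
  where
  regroup : ∀ x y z → (x + y) - (y + z) ≡ (x - y) + (y - z)
  regroup = solve-∀

K-zeroʳ-ratio : ∀ a m → m * K a 0 m + (+ a + 1ℤ - m) * K a 0 (m - 1ℤ) ≡ 0ℤ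
K-zeroʳ-ratio zero    (+ zero)          = refl
K-zeroʳ-ratio zero    (+ suc zero)      = refl
K-zeroʳ-ratio zero    (+ suc (suc x))   = cong₂ _+_ (ℤₚ.*-zeroʳ (+ suc (suc x))) (ℤₚ.*-zeroʳ (+ 1 - + suc (suc x)))
K-zeroʳ-ratio zero    -[1+ x ]          = cong₂ _+_ (ℤₚ.*-zeroʳ -[1+ x ]) (ℤₚ.*-zeroʳ (+ 1 - -[1+ x ]))
K-zeroʳ-ratio (suc a) m = trans (regroup m (+ a) (K a 0 m) (K a 0 (m - 1ℤ)) (K a 0 (m - 1ℤ - 1ℤ)))
                           (cong₂ _-_ (K-zeroʳ-ratio a m) (K-zeroʳ-ratio a (m - 1ℤ)))
  where
  regroup : ∀ m A X Y Z → m * (X - Y) + (1ℤ + A + 1ℤ - m) * (Y - Z)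
                        ≡ (m * X + (A + 1ℤ - m) * Y) - ((m - 1ℤ) * Y + (A + 1ℤ - (m - 1ℤ)) * Z)
  regroup = solve-∀

-- For b = 0 (resp. a = 0) the first (resp. second) term multiplies the junk value at ℕ.pred 0 = 0 by zero.
K-three-term : ∀ a b m → + b * K (suc a) (ℕ.pred b) m + + a * K (ℕ.pred a) (suc b) m
                       ≡ (+ a + + b - m - m) * K a b m
K-three-term zero    zero    (+ zero)  = refl
K-three-term zero    zero    (+ suc x) = sym (ℤₚ.*-zeroʳ (0ℤ - + suc x - + suc x))
K-three-term zero    zero    -[1+ x ]  = sym (ℤₚ.*-zeroʳ (0ℤ - -[1+ x ] - -[1+ x ]))
K-three-term (suc a) zero    m = begin
  0ℤ + + suc a * K a 1 m                       ≡⟨ ℤₚ.+-identityˡ _ ⟩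
  + suc a * K a 1 m                            ≡⟨ cong (+ suc a *_) (K-sucʳ a 0 m) ⟩
  + suc a * (K a 0 m + K a 0 (m - 1ℤ))         ≡⟨ regroup (+ a) m (K a 0 m) (K a 0 (m - 1ℤ)) ⟩
  c * K (suc a) 0 m + + 2 * (m * K a 0 m + (+ a + 1ℤ - m) * K a 0 (m - 1ℤ))
                                               ≡⟨ cong (λ t → c * K (suc a) 0 m + + 2 * t) (K-zeroʳ-ratio a m) ⟩
  c * K (suc a) 0 m + 0ℤ                       ≡⟨ ℤₚ.+-identityʳ _ ⟩
  c * K (suc a) 0 m                            ∎
  where
  open ≡-Reasoning
  c : ℤ
  c = + suc a + 0ℤ - m - m
  regroup : ∀ A m X Y → (1ℤ + A) * (X + Y) ≡ (1ℤ + A + 0ℤ - m - m) * (X - Y) + + 2 * (m * X + (A + 1ℤ - m) * Y)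
  regroup = solve-∀
K-three-term a (suc b) m = begin
  + suc b * X + + a * K (ℕ.pred a) (suc (suc b)) m
    ≡⟨ cong₂ _+_ (trans (ℤₚ.*-distribʳ-+ X 1ℤ (+ b)) (cong₂ _+_ (ℤₚ.*-identityˡ X) (pred-split b)))
                 (cong (+ a *_) (K-sucʳ (ℕ.pred a) (suc b) m)) ⟩
  (X + + b * (Q m + Q (m - 1ℤ))) + + a * (P m + P (m - 1ℤ))
    ≡⟨ regroup X (+ b) (+ a) (Q m) (Q (m - 1ℤ)) (P m) (P (m - 1ℤ)) ⟩
  (+ b * Q m + + a * P m) + (+ b * Q (m - 1ℤ) + + a * P (m - 1ℤ)) + X
    ≡⟨ cong₂ (λ u v → u + v + X) (K-three-term a b m) (K-three-term a b (m - 1ℤ)) ⟩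
  (+ a + + b - m - m) * K a b m + (+ a + + b - (m - 1ℤ) - (m - 1ℤ)) * K a b (m - 1ℤ) + (K a b m - K a b (m - 1ℤ))
    ≡⟨ collect (+ a) (+ b) m (K a b m) (K a b (m - 1ℤ)) ⟩
  (+ a + + suc b - m - m) * (K a b m + K a b (m - 1ℤ))
    ≡⟨ cong ((+ a + + suc b - m - m) *_) (sym (K-sucʳ a b m)) ⟩
  (+ a + + suc b - m - m) * K a (suc b) m ∎
  where
  open ≡-Reasoning
  X : ℤ
  X = K (suc a) b m
  Q P : ℤ → ℤ
  Q = K (suc a) (ℕ.pred b)
  P = K (ℕ.pred a) (suc b)
  pred-split : ∀ b → + b * K (suc a) b m ≡ + b * (K (suc a) (ℕ.pred b) m + K (suc a) (ℕ.pred b) (m - 1ℤ))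
  pred-split zero    = refl
  pred-split (suc b) = cong (+ suc b *_) (K-sucʳ (suc a) b m)
  regroup : ∀ x b a q q' p p' → (x + b * (q + q')) + a * (p + p') ≡ (b * q + a * p) + (b * q' + a * p') + x
  regroup = solve-∀
  collect : ∀ a b m y y' → (a + b - m - m) * y + (a + b - (m - 1ℤ) - (m - 1ℤ)) * y' + (y - y')
                         ≡ (a + (1ℤ + b) - m - m) * (y + y')
  collect = solve-∀

middle-coefficient : ∀ {c} M → c ≡ M ℕ.+ M → + c - + M - + M ≡ 0ℤ
middle-coefficient {c} M refl = trans (cong (λ x → x - + M - + M) (ℤₚ.pos-+ M M)) (cancel (+ M))
  where
  cancel : ∀ x → x + x - x - x ≡ 0ℤ
  cancel = solve-∀

K-middle : ∀ M a b → suc a ℕ.+ suc b ≡ M ℕ.+ M →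
           + suc b * K (suc (suc a)) b (+ M) + + suc a * K a (suc (suc b)) (+ M) ≡ 0ℤ
K-middle M a b a+b≡2M =
  trans (K-three-term (suc a) (suc b) (+ M))
        (trans (cong (_* K (suc a) (suc b) (+ M)) (middle-coefficient M a+b≡2M))
               (ℤₚ.*-zeroˡ (K (suc a) (suc b) (+ M))))

suc*≡0⇒≡0 : ∀ c {x} → + suc c * x ≡ 0ℤ → x ≡ 0ℤ
suc*≡0⇒≡0 c {x} cx≡0 = ℤₚ.*-cancelˡ-≡ (+ suc c) x 0ℤ (trans cx≡0 (sym (ℤₚ.*-zeroʳ (+ suc c))))

K-middle-odd : ∀ M i b → suc (i ℕ.+ i) ℕ.+ b ≡ M ℕ.+ M → K (suc (i ℕ.+ i)) b (+ M) ≡ 0ℤ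
K-middle-odd M zero b 1+b≡2M = suc*≡0⇒≡0 b (begin
  + suc b * K 1 b (+ M)                                 ≡⟨ sym (ℤₚ.+-identityʳ _) ⟩
  + suc b * K 1 b (+ M) + 0ℤ * K 0 (suc (suc b)) (+ M)  ≡⟨ K-three-term 0 (suc b) (+ M) ⟩
  (0ℤ + + suc b - + M - + M) * K 0 (suc b) (+ M)        ≡⟨ cong (_* K 0 (suc b) (+ M)) (middle-coefficient M 1+b≡2M) ⟩
  0ℤ * K 0 (suc b) (+ M)                                ≡⟨ ℤₚ.*-zeroˡ (K 0 (suc b) (+ M)) ⟩
  0ℤ                                                    ∎)
  where open ≡-Reasoning
K-middle-odd M (suc i) b 2i+3+b≡2M =
  subst (λ a → K a b (+ M) ≡ 0ℤ) (cong (suc ∘ suc) (sym (ℕₚ.+-suc i i))) (suc*≡0⇒≡0 b (begin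
    + suc b * K (3 ℕ.+ (i ℕ.+ i)) b (+ M)
      ≡⟨ sym (ℤₚ.+-identityʳ _) ⟩
    + suc b * K (3 ℕ.+ (i ℕ.+ i)) b (+ M) + 0ℤ
      ≡⟨ cong (_+_ (+ suc b * K (3 ℕ.+ (i ℕ.+ i)) b (+ M))) (sym inner≡0) ⟩
    + suc b * K (3 ℕ.+ (i ℕ.+ i)) b (+ M) + + suc (suc (i ℕ.+ i)) * K (suc (i ℕ.+ i)) (suc (suc b)) (+ M)
      ≡⟨ K-middle M (suc (i ℕ.+ i)) b (trans (shift₁ i b) 2i+3+b≡2M) ⟩
    0ℤ ∎))
  where
  open ≡-Reasoning
  shift₁ : ∀ i b → suc (suc (i ℕ.+ i)) ℕ.+ suc b ≡ suc (suc i ℕ.+ suc i) ℕ.+ b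
  shift₁ = ℕ-solve-∀
  shift₂ : ∀ i b → suc (i ℕ.+ i) ℕ.+ suc (suc b) ≡ suc (suc i ℕ.+ suc i) ℕ.+ b
  shift₂ = ℕ-solve-∀
  inner≡0 : + suc (suc (i ℕ.+ i)) * K (suc (i ℕ.+ i)) (suc (suc b)) (+ M) ≡ 0ℤ
  inner≡0 = trans (cong (+ suc (suc (i ℕ.+ i)) *_) (K-middle-odd M i (suc (suc b)) (trans (shift₂ i b) 2i+3+b≡2M)))
                  (ℤₚ.*-zeroʳ (+ suc (suc (i ℕ.+ i))))

private
  reflect-− : ∀ {X Y : ℤ → ℤ} → (∀ x → X -[1+ x ] ≡ 0ℤ) → (∀ x → Y -[1+ x ] ≡ 0ℤ) →
              (∀ m → X (+ m) ≡ signℤ m * Y (+ m)) →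
              ∀ m → X (+ m) - X (+ m - 1ℤ) ≡ signℤ m * (Y (+ m) + Y (+ m - 1ℤ))
  reflect-− {X} {Y} X⁻≡0 Y⁻≡0 X≡±Y zero =
    trans (cong₂ _-_ (X≡±Y 0) (X⁻≡0 0)) (trans (base (Y (+ 0))) (cong (λ y → 1ℤ * (Y (+ 0) + y)) (sym (Y⁻≡0 0))))
    where
    base : ∀ y → 1ℤ * y - 0ℤ ≡ 1ℤ * (y + 0ℤ)
    base = solve-∀
  reflect-− {X} {Y} X⁻≡0 Y⁻≡0 X≡±Y (suc m) =
    trans (cong₂ _-_ (X≡±Y (suc m)) (X≡±Y m)) (step (signℤ m) (Y (+ suc m)) (Y (+ m)))
    where
    step : ∀ s y y′ → (- s) * y - s * y′ ≡ (- s) * (y + y′)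
    step = solve-∀

  reflect-+ : ∀ {X Y : ℤ → ℤ} → (∀ x → X -[1+ x ] ≡ 0ℤ) → (∀ x → Y -[1+ x ] ≡ 0ℤ) →
              (∀ m → X (+ m) ≡ signℤ m * Y (+ m)) →
              ∀ m → X (+ m) + X (+ m - 1ℤ) ≡ signℤ m * (Y (+ m) - Y (+ m - 1ℤ))
  reflect-+ {X} {Y} X⁻≡0 Y⁻≡0 X≡±Y zero =
    trans (cong₂ _+_ (X≡±Y 0) (X⁻≡0 0)) (trans (base (Y (+ 0))) (cong (λ y → 1ℤ * (Y (+ 0) - y)) (sym (Y⁻≡0 0))))
    where
    base : ∀ y → 1ℤ * y + 0ℤ ≡ 1ℤ * (y - 0ℤ)
    base = solve-∀
  reflect-+ {X} {Y} X⁻≡0 Y⁻≡0 X≡±Y (suc m) =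
    trans (cong₂ _+_ (X≡±Y (suc m)) (X≡±Y m)) (step (signℤ m) (Y (+ suc m)) (Y (+ m)))
    where
    step : ∀ s y y′ → (- s) * y + s * y′ ≡ (- s) * (y - y′)
    step = solve-∀

-- Substituting -x for x in (1 - x)^a (1 + x)^b swaps the two factors.
K-swap : ∀ a b m → K b a (+ m) ≡ signℤ m * K a b (+ m)
K-swap zero zero zero    = refl
K-swap zero zero (suc m) = sym (ℤₚ.*-zeroʳ (signℤ (suc m)))
K-swap zero (suc b) m = reflect-− {K b 0} {K 0 b} (K-negative b 0) (K-negative 0 b) (K-swap 0 b) m
K-swap (suc a) b m =
  trans (K-sucʳ b a (+ m)) (reflect-+ {K b a} {K a b} (K-negative b a) (K-negative a b) (K-swap a b) m)

K-zeroˡ-nonneg : ∀ b m → 0ℤ ≤ K 0 b m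
K-zeroˡ-nonneg zero    (+ zero)  = +≤+ z≤n
K-zeroˡ-nonneg zero    (+ suc x) = +≤+ z≤n
K-zeroˡ-nonneg zero    -[1+ x ]  = +≤+ z≤n
K-zeroˡ-nonneg (suc b) m         = ℤₚ.+-mono-≤ (K-zeroˡ-nonneg b m) (K-zeroˡ-nonneg b (m - 1ℤ))

K-zeroˡ-pos : ∀ b m → m ℕ.≤ b → 0ℤ < K 0 b (+ m)
K-zeroˡ-pos zero    zero    _         = +<+ (s≤s z≤n)
K-zeroˡ-pos (suc b) zero    _         = ℤₚ.+-mono-<-≤ (K-zeroˡ-pos b 0 z≤n) (K-zeroˡ-nonneg b -[1+ 0 ])
K-zeroˡ-pos (suc b) (suc m) (s≤s m≤b) = ℤₚ.+-mono-≤-< (K-zeroˡ-nonneg b (+ suc m)) (K-zeroˡ-pos b m m≤b)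

sphere : ∀ {n} → ℕ → Subset n → ℤ
sphere m A = if does (∣ A ∣ ℕ.≟ m) then 1ℤ else 0ℤ

fourier-sphere : ∀ {n} m (S : Subset n) → fourier (sphere m) S ≡ K ∣ S ∣ ∣ ∁ S ∣ (+ m)
fourier-sphere zero    [] = refl
fourier-sphere (suc m) [] = refl
fourier-sphere {suc n} zero (false ∷ S) =
  trans (cong₂ _+_ (fourier-sphere 0 S) (∑-zero {n} (λ _ → refl)))
        (trans (cong (_+_ (K ∣ S ∣ ∣ ∁ S ∣ (+ 0))) (sym (K-negative ∣ S ∣ ∣ ∁ S ∣ 0)))
               (sym (K-sucʳ ∣ S ∣ ∣ ∁ S ∣ (+ 0))))
fourier-sphere {suc n} (suc m) (false ∷ S) =
  trans (cong₂ _+_ (fourier-sphere (suc m) S) (fourier-sphere m S)) (sym (K-sucʳ ∣ S ∣ ∣ ∁ S ∣ (+ suc m)))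
fourier-sphere {suc n} zero (true ∷ S) =
  cong₂ _+_ (fourier-sphere 0 S) (trans (∑-zero {n} (λ _ → refl)) (cong -_ (sym (K-negative ∣ S ∣ ∣ ∁ S ∣ 0))))
fourier-sphere {suc n} (suc m) (true ∷ S) =
  cong₂ _+_ (fourier-sphere (suc m) S)
            (trans (∑-cong (λ A → sym (ℤₚ.neg-distribʳ-* (sphere m A) (walsh A S))))
                   (trans (∑-neg (λ A → sphere m A * walsh A S)) (cong -_ (fourier-sphere m S))))

module Descent (G : ℕ → ℕ → ℕ) (L : ℕ)
  (ratio : ∀ i l → i ℕ.+ l ≡ L → suc (l ℕ.+ l) ℕ.* G (suc i) l ≡ suc (i ℕ.+ i) ℕ.* G i (suc l)) where

  open ℕₚ.≤-Reasoning

  ratio-≤ : ∀ i l → i ℕ.+ l ≡ L → i ℕ.≤ l → G (suc i) l ℕ.≤ G i (suc l)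
  ratio-≤ i l i+l≡L i≤l = ℕₚ.*-cancelˡ-≤ (suc (l ℕ.+ l)) (begin
    suc (l ℕ.+ l) ℕ.* G (suc i) l  ≡⟨ ratio i l i+l≡L ⟩
    suc (i ℕ.+ i) ℕ.* G i (suc l)  ≤⟨ ℕₚ.*-monoˡ-≤ (G i (suc l)) (s≤s (ℕₚ.+-mono-≤ i≤l i≤l)) ⟩
    suc (l ℕ.+ l) ℕ.* G i (suc l)  ∎)

  ratio-< : ∀ i l → i ℕ.+ l ≡ L → i ℕ.< l → 0 ℕ.< G i (suc l) → G (suc i) l ℕ.< G i (suc l)
  ratio-< i l i+l≡L i<l G>0 = ℕₚ.*-cancelˡ-< (suc (l ℕ.+ l)) _ _ (begin-strict
    suc (l ℕ.+ l) ℕ.* G (suc i) l  ≡⟨ ratio i l i+l≡L ⟩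
    suc (i ℕ.+ i) ℕ.* G i (suc l)  <⟨ ℕₚ.*-monoˡ-< (G i (suc l)) {{ℕ.>-nonZero G>0}} (s≤s (ℕₚ.+-mono-< i<l i<l)) ⟩
    suc (l ℕ.+ l) ℕ.* G i (suc l)  ∎)

  descent : ∀ k i l → k ℕ.+ i ℕ.+ l ≡ suc L → k ℕ.+ i ℕ.≤ l → G (k ℕ.+ i) l ℕ.≤ G k (i ℕ.+ l)
  descent k zero    l _  _ = ℕₚ.≤-reflexive (cong (λ a → G a l) (ℕₚ.+-identityʳ k))
  descent k (suc i) l eq k+i<l = begin
    G (k ℕ.+ suc i) l    ≡⟨ cong (λ a → G a l) (ℕₚ.+-suc k i) ⟩
    G (suc (k ℕ.+ i)) l  ≤⟨ ratio-≤ (k ℕ.+ i) l (ℕₚ.suc-injective eq′) (ℕₚ.<⇒≤ k+i<l′) ⟩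
    G (k ℕ.+ i) (suc l)  ≤⟨ descent k i (suc l) (trans (ℕₚ.+-suc (k ℕ.+ i) l) eq′) (ℕₚ.m≤n⇒m≤1+n (ℕₚ.<⇒≤ k+i<l′)) ⟩
    G k (i ℕ.+ suc l)    ≡⟨ cong (G k) (ℕₚ.+-suc i l) ⟩
    G k (suc i ℕ.+ l)    ∎
    where
    eq′ : suc (k ℕ.+ i ℕ.+ l) ≡ suc L
    eq′ = trans (cong (ℕ._+ l) (sym (ℕₚ.+-suc k i))) eq
    k+i<l′ : suc (k ℕ.+ i) ℕ.≤ l
    k+i<l′ = subst (ℕ._≤ l) (ℕₚ.+-suc k i) k+i<l

  peak-bound : 0 ℕ.< G 0 (suc L) → ∀ i l → i ℕ.+ l ≡ suc L → 1 ℕ.≤ i → i ℕ.≤ l →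
               suc (L ℕ.+ L) ℕ.* G i l ℕ.≤ G 0 (suc L) × (2 ℕ.≤ i → suc (L ℕ.+ L) ℕ.* G i l ℕ.< G 0 (suc L))
  peak-bound D>0 (suc j) l j+l≡L _ i≤l =
    ℕₚ.≤-trans (ℕₚ.*-monoʳ-≤ c G≤G₁) (ℕₚ.≤-reflexive peak) , off-peak j l j+l≡L i≤l
    where
    c : ℕ
    c = suc (L ℕ.+ L)
    peak : c ℕ.* G 1 L ≡ G 0 (suc L)
    peak = trans (ratio 0 L refl) (ℕₚ.*-identityˡ (G 0 (suc L)))
    G₁>0 : 0 ℕ.< G 1 L
    G₁>0 = ℕₚ.n≢0⇒n>0 λ G₁≡0 → ℕₚ.<⇒≢ D>0 (sym (trans (sym peak) (trans (cong (c ℕ.*_) G₁≡0) (ℕₚ.*-zeroʳ c))))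
    G≤G₁ : G (suc j) l ℕ.≤ G 1 L
    G≤G₁ = subst (λ l′ → G (suc j) l ℕ.≤ G 1 l′) (ℕₚ.suc-injective j+l≡L) (descent 1 j l j+l≡L i≤l)
    off-peak : ∀ j l → suc j ℕ.+ l ≡ suc L → suc j ℕ.≤ l → 2 ℕ.≤ suc j → c ℕ.* G (suc j) l ℕ.< G 0 (suc L)
    off-peak zero    l _ _ (s≤s ())
    off-peak (suc j) l j+l≡L i≤l _ = ℕₚ.<-≤-trans (ℕₚ.*-monoʳ-< c G<G₁) (ℕₚ.≤-reflexive peak)
      where
      L≡′ : suc (j ℕ.+ l) ≡ L
      L≡′ = ℕₚ.suc-injective j+l≡L
      1<j+l : 1 ℕ.< j ℕ.+ l
      1<j+l = ℕₚ.≤-trans (ℕₚ.≤-trans (s≤s (s≤s z≤n)) i≤l) (ℕₚ.m≤n+m l j)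
      G<G₁ : G (suc (suc j)) l ℕ.< G 1 L
      G<G₁ = begin-strict
        G (suc (suc j)) l      ≤⟨ descent 2 j l j+l≡L i≤l ⟩
        G 2 (j ℕ.+ l)          <⟨ ratio-< 1 (j ℕ.+ l) L≡′ 1<j+l (subst (0 ℕ.<_) (cong (G 1) (sym L≡′)) G₁>0) ⟩
        G 1 (suc (j ℕ.+ l))    ≡⟨ cong (G 1) L≡′ ⟩
        G 1 L                  ∎

+≡0⇒∣∣≡∣∣ : ∀ x y → x + y ≡ 0ℤ → ℤ.∣ x ∣ ≡ ℤ.∣ y ∣
+≡0⇒∣∣≡∣∣ x y x+y≡0 = trans (cong ℤ.∣_∣ (inverseˡ-unique x y x+y≡0)) (ℤₚ.∣-i∣≡∣i∣ y)

∣K∣-ratio : ∀ L i l → i ℕ.+ l ≡ L →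
            suc (l ℕ.+ l) ℕ.* ℤ.∣ K (suc i ℕ.+ suc i) (l ℕ.+ l) (+ suc L) ∣
            ≡ suc (i ℕ.+ i) ℕ.* ℤ.∣ K (i ℕ.+ i) (suc l ℕ.+ suc l) (+ suc L) ∣
∣K∣-ratio L i l refl = begin
  suc (l ℕ.+ l) ℕ.* ℤ.∣ K (suc i ℕ.+ suc i) (l ℕ.+ l) (+ M) ∣
    ≡⟨ cong (λ a → suc (l ℕ.+ l) ℕ.* ℤ.∣ K (suc a) (l ℕ.+ l) (+ M) ∣) (ℕₚ.+-suc i i) ⟩
  suc (l ℕ.+ l) ℕ.* ℤ.∣ X ∣         ≡⟨ sym (ℤₚ.abs-* (+ suc (l ℕ.+ l)) X) ⟩
  ℤ.∣ + suc (l ℕ.+ l) * X ∣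
    ≡⟨ +≡0⇒∣∣≡∣∣ (+ suc (l ℕ.+ l) * X) (+ suc (i ℕ.+ i) * Y) (K-middle M (i ℕ.+ i) (l ℕ.+ l) (diagonal i l)) ⟩
  ℤ.∣ + suc (i ℕ.+ i) * Y ∣         ≡⟨ ℤₚ.abs-* (+ suc (i ℕ.+ i)) Y ⟩
  suc (i ℕ.+ i) ℕ.* ℤ.∣ Y ∣
    ≡⟨ cong (λ b → suc (i ℕ.+ i) ℕ.* ℤ.∣ K (i ℕ.+ i) (suc b) (+ M) ∣) (sym (ℕₚ.+-suc l l)) ⟩
  suc (i ℕ.+ i) ℕ.* ℤ.∣ K (i ℕ.+ i) (suc l ℕ.+ suc l) (+ M) ∣ ∎
  where
  open ≡-Reasoning
  M : ℕ
  M = suc (i ℕ.+ l)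
  X Y : ℤ
  X = K (suc (suc (i ℕ.+ i))) (l ℕ.+ l) (+ M)
  Y = K (i ℕ.+ i) (suc (suc (l ℕ.+ l))) (+ M)
  diagonal : ∀ i l → suc (i ℕ.+ i) ℕ.+ suc (l ℕ.+ l) ≡ suc (i ℕ.+ l) ℕ.+ suc (i ℕ.+ l)
  diagonal = ℕ-solve-∀

-- The weight (n - 1) K + D

*-nonneg : ∀ {a b} → 0ℤ ≤ a → 0ℤ ≤ b → 0ℤ ≤ a * b
*-nonneg {a} {b} a≥0 b≥0 = subst (_≤ a * b) (ℤₚ.*-zeroʳ a) (ℤₚ.*-monoˡ-≤-nonNeg a {{ℤ.nonNegative a≥0}} b≥0)

square-nonneg : ∀ x → 0ℤ ≤ x * x
square-nonneg (+ m)    = subst (0ℤ ≤_) (ℤₚ.pos-* m m) (+≤+ z≤n)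
square-nonneg -[1+ m ] = +≤+ z≤n

positive-shift : ∀ c {x d} → 0ℤ ≤ x → 0ℤ < d → 0ℤ < + c * x + d
positive-shift c {+ g} _ d>0 = subst (λ t → 0ℤ < t + _) (ℤₚ.pos-* c g) (ℤₚ.+-mono-≤-< (+≤+ z≤n) d>0)

bounded-shift : ∀ c x D → c ℕ.* ℤ.∣ x ∣ ℕ.≤ D →
                0ℤ ≤ + c * x + + D × (+ c * x + + D ≡ 0ℤ → c ℕ.* ℤ.∣ x ∣ ≡ D)
bounded-shift c (+ g) D _ = subst (λ t → 0ℤ ≤ t + + D) (ℤₚ.pos-* c g) (+≤+ z≤n) , λ sum≡0 →
  let c*g+D≡0 = ℤₚ.+-injective (trans (cong (_+ + D) (ℤₚ.pos-* c g)) sum≡0)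
  in trans (ℕₚ.m+n≡0⇒m≡0 (c ℕ.* g) c*g+D≡0) (sym (ℕₚ.m+n≡0⇒n≡0 (c ℕ.* g) c*g+D≡0))
bounded-shift c -[1+ g ] D cx≤D = subst (0ℤ ≤_) (sym shift≡) (+≤+ z≤n) , λ sum≡0 →
  ℕₚ.≤-antisym cx≤D (ℕₚ.m∸n≡0⇒m≤n (ℤₚ.+-injective (trans (sym shift≡) sum≡0)))
  where
  shift≡ : + c * -[1+ g ] + + D ≡ + (D ℕ.∸ c ℕ.* suc g)
  shift≡ = trans (cong (_+ + D) (neg-* c)) (trans (ℤₚ.-m+n≡n⊖m (c ℕ.* suc g) D) (ℤₚ.⊖-≥ cx≤D))
    where
    neg-* : ∀ c → + c * -[1+ g ] ≡ - + (c ℕ.* suc g)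
    neg-* zero    = refl
    neg-* (suc c) = refl

slack≡0 : ∀ {x R} → x + R ≡ x → R ≡ 0ℤ
slack≡0 {x} {R} x+R≡x = trans (isolate x R) (trans (cong (_- x) x+R≡x) (ℤₚ.+-inverseʳ x))
  where
  isolate : ∀ x r → r ≡ x + r - x
  isolate = solve-∀

slack-bound : ∀ {x a b R} → 0ℤ < x → 0ℤ ≤ R → x * a + R ≡ x * b → a ≤ b
slack-bound {x} {a} {b} {R} x>0 R≥0 eq =
  ℤₚ.*-cancelˡ-≤-pos a b x {{ℤ.positive x>0}} (subst (x * a ≤_) eq (ℤₚ.i≤i+j (x * a) R {{ℤ.nonNegative R≥0}}))

cancel-bound : ∀ N P s {D R} → 0ℤ < D → 0ℤ ≤ R → + N * D * (+ s * + s) + R ≡ D * (+ P * + s) →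
               s ℕ.* N ℕ.≤ P × (s ℕ.* N ≡ P → R ≡ 0ℤ)
cancel-bound N P s {D} {R} D>0 R≥0 eq =
  bound s scaled , λ sN≡P → slack≡0 (trans (cong (λ t → D * + s * + t + R) (sym sN≡P)) scaled)
  where
  scaled : D * + s * + (s ℕ.* N) + R ≡ D * + s * + P
  scaled = begin
    D * + s * + (s ℕ.* N) + R  ≡⟨ cong (λ t → D * + s * t + R) (ℤₚ.pos-* s N) ⟩
    D * + s * (+ s * + N) + R  ≡⟨ cong (_+ R) (regroupˡ (+ N) D (+ s)) ⟩
    + N * D * (+ s * + s) + R  ≡⟨ eq ⟩
    D * (+ P * + s)            ≡⟨ regroupʳ D (+ P) (+ s) ⟩
    D * + s * + P              ∎
    where
    open ≡-Reasoning
    regroupˡ : ∀ n d s → d * s * (s * n) ≡ n * d * (s * s)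
    regroupˡ = solve-∀
    regroupʳ : ∀ d p s → d * (p * s) ≡ d * s * p
    regroupʳ = solve-∀
  bound : ∀ t → D * + t * + (t ℕ.* N) + R ≡ D * + t * + P → t ℕ.* N ℕ.≤ P
  bound zero    _  = z≤n
  bound (suc t) eq = ℤₚ.drop‿+≤+ (slack-bound (ℤₚ.*-monoʳ-<-pos (+ suc t) D>0) R≥0 eq)

data Parity : ℕ → Set where
  even : ∀ i → Parity (i ℕ.+ i)
  odd  : ∀ i → Parity (suc (i ℕ.+ i))

parity : ∀ a → Parity a
parity zero = even 0
parity (suc a) with parity a
... | even i = odd i
... | odd  i = subst Parity (cong suc (ℕₚ.+-suc i i)) (even (suc i))

double-injective : ∀ {x y} → x ℕ.+ x ≡ y ℕ.+ y → x ≡ y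
double-injective {x} {y} eq with ℕₚ.<-cmp x y
... | tri< x<y _ _ = ⊥-elim (ℕₚ.<⇒≢ (ℕₚ.+-mono-< x<y x<y) eq)
... | tri≈ _ x≡y _ = x≡y
... | tri> _ _ y<x = ⊥-elim (ℕₚ.<⇒≢ (ℕₚ.+-mono-< y<x y<x) (sym eq))

-- M = L + 1 = n/2 must be even: otherwise K (M + M) 0 M = -D and the weight is negative at S = [n].
module MiddleBound (L : ℕ) (M-even : signℤ (suc L) ≡ 1ℤ) where

  M c : ℕ
  M = suc L
  c = suc (L ℕ.+ L)

  K-symmetric : ∀ a b → K b a (+ M) ≡ K a b (+ M)
  K-symmetric a b = trans (K-swap a b M) (trans (cong (_* K a b (+ M)) M-even) (ℤₚ.*-identityˡ (K a b (+ M))))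

  G : ℕ → ℕ → ℕ
  G i l = ℤ.∣ K (i ℕ.+ i) (l ℕ.+ l) (+ M) ∣

  open Descent G L (∣K∣-ratio L)

  D>0 : 0 ℕ.< G 0 M
  D>0 with K 0 (M ℕ.+ M) (+ M) | K-zeroˡ-pos (M ℕ.+ M) M (ℕₚ.m≤n+m M M)
  ... | + suc _ | _       = s≤s z≤n
  ... | + zero  | +<+ ()

  PeakBounded : ℕ → Set → Set
  PeakBounded x P = c ℕ.* x ℕ.≤ G 0 M × (c ℕ.* x ≡ G 0 M → P)

  at-edge : ∀ {x} j → c ℕ.* x ℕ.≤ G 0 M × (2 ℕ.≤ suc j → c ℕ.* x ℕ.< G 0 M) → PeakBounded x (j ≡ 0)
  at-edge zero    (≤D , _)  = ≤D , λ _ → refl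
  at-edge (suc j) (≤D , <D) = ≤D , λ ≡D → ⊥-elim (ℕₚ.<⇒≢ (<D (s≤s (s≤s z≤n))) ≡D)

  interior : ∀ i l → suc i ℕ.+ suc l ≡ M → PeakBounded (G (suc i) (suc l)) (i ≡ 0 ⊎ l ≡ 0)
  interior i l i+l≡M with ℕₚ.≤-total i l
  ... | inj₁ i≤l = map₂ (inj₁ ∘_) (at-edge i (peak-bound D>0 (suc i) (suc l) i+l≡M (s≤s z≤n) (s≤s i≤l)))
  ... | inj₂ l≤i =
    subst (λ g → PeakBounded g (i ≡ 0 ⊎ l ≡ 0)) (cong ℤ.∣_∣ (K-symmetric (suc i ℕ.+ suc i) (suc l ℕ.+ suc l)))
          (map₂ (inj₂ ∘_) (at-edge l (peak-bound D>0 (suc l) (suc i) l+i≡M (s≤s z≤n) (s≤s l≤i))))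
    where
    l+i≡M : suc l ℕ.+ suc i ≡ M
    l+i≡M = trans (ℕₚ.+-comm (suc l) (suc i)) i+l≡M

  K-middle-bound : ∀ a b → a ℕ.+ b ≡ M ℕ.+ M → 0ℤ ≤ K a b (+ M) ⊎ PeakBounded ℤ.∣ K a b (+ M) ∣ (a ≡ 2 ⊎ b ≡ 2)
  K-middle-bound a b a+b≡2M with parity a | parity b
  ... | odd i        | _            = inj₁ (ℤₚ.≤-reflexive (sym (K-middle-odd M i b a+b≡2M)))
  ... | even i       | odd j        =
    inj₁ (ℤₚ.≤-reflexive (sym (trans (K-symmetric (suc (j ℕ.+ j)) (i ℕ.+ i))
                                     (K-middle-odd M j (i ℕ.+ i) (trans (ℕₚ.+-comm (suc (j ℕ.+ j)) (i ℕ.+ i)) a+b≡2M)))))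
  ... | even zero    | even l       = inj₁ (K-zeroˡ-nonneg (l ℕ.+ l) (+ M))
  ... | even (suc i) | even zero    =
    inj₁ (subst (0ℤ ≤_) (K-symmetric (suc i ℕ.+ suc i) 0) (K-zeroˡ-nonneg (suc i ℕ.+ suc i) (+ M)))
  ... | even (suc i) | even (suc l) =
    inj₂ (map₂ (Sum.map (cong (λ i → suc i ℕ.+ suc i)) (cong (λ l → suc l ℕ.+ suc l)) ∘_)
               (interior i l (double-injective (trans (regroup (suc i) (suc l)) a+b≡2M))))
    where
    regroup : ∀ i l → (i ℕ.+ l) ℕ.+ (i ℕ.+ l) ≡ (i ℕ.+ i) ℕ.+ (l ℕ.+ l)
    regroup = ℕ-solve-∀

  -- The Fourier transform of (n - 1) [|A| = M] + D [A = ∅] at any S with |S| = a and |∁ S| = b.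
  weight : ℕ → ℕ → ℤ
  weight a b = + c * K a b (+ M) + K 0 (M ℕ.+ M) (+ M)

  weight-nonneg : ∀ a b → a ℕ.+ b ≡ M ℕ.+ M → 0ℤ ≤ weight a b × (weight a b ≡ 0ℤ → a ≡ 2 ⊎ b ≡ 2)
  weight-nonneg a b a+b≡2M with K-middle-bound a b a+b≡2M
  ... | inj₁ K≥0 = ℤₚ.<⇒≤ w>0 , λ w≡0 → ⊥-elim (ℤₚ.<⇒≢ w>0 (sym w≡0))
    where
    w>0 : 0ℤ < weight a b
    w>0 = positive-shift c K≥0 (K-zeroˡ-pos (M ℕ.+ M) M (ℕₚ.m≤n+m M M))
  ... | inj₂ (bound , at-peak) =
    subst (λ w → 0ℤ ≤ w × (w ≡ 0ℤ → a ≡ 2 ⊎ b ≡ 2)) (cong (_+_ (+ c * K a b (+ M))) D≡)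
          (map₂ (at-peak ∘_) (bounded-shift c (K a b (+ M)) (G 0 M) bound))
    where
    D≡ : + G 0 M ≡ K 0 (M ℕ.+ M) (+ M)
    D≡ = ℤₚ.0≤i⇒+∣i∣≡i (K-zeroˡ-nonneg (M ℕ.+ M) (+ M))

indicator : ∀ {n} → (Subset n → Bool) → Subset n → ℤ
indicator I A = if I A then 1ℤ else 0ℤ

indicator-idem : ∀ {n} (I : Subset n → Bool) A → indicator I A * indicator I A ≡ indicator I A
indicator-idem I A with I A
... | true  = refl
... | false = refl

module _ {n} (m : ℕ) (I : Subset n → Bool) (avoids : ∀ A B → I A ≡ true → I B ≡ true → ¬ ∣ A △ B ∣ ≡ m) where

  private
    f : Subset n → ℤ
    f = indicator I

  sphere-orthogonal : ∀ A B → f A * f B * sphere m (A △ B) ≡ 0ℤ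
  sphere-orthogonal A B with I A in IA | I B in IB
  ... | true  | true  = cong (λ b → 1ℤ * (if b then 1ℤ else 0ℤ)) (dec-false (∣ A △ B ∣ ℕ.≟ m) (avoids A B IA IB))
  ... | true  | false = refl
  ... | false | _     = refl

  weighted-energy : ∀ c D → ∑[ S ⊆ n ] ((c * K ∣ S ∣ ∣ ∁ S ∣ (+ m) + D) * (fourier f S * fourier f S))
                            ≡ D * (+ 2 ℕ.^ n * ∑ n f)
  weighted-energy c D = begin
    ∑[ S ⊆ n ] ((c * K ∣ S ∣ ∣ ∁ S ∣ (+ m) + D) * Q S)
      ≡⟨ ∑-cong (λ S → expand c (K ∣ S ∣ ∣ ∁ S ∣ (+ m)) D (Q S)) ⟩
    ∑[ S ⊆ n ] (c * (K ∣ S ∣ ∣ ∁ S ∣ (+ m) * Q S) + D * Q S)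
      ≡⟨ trans (∑-+ (λ S → c * (K ∣ S ∣ ∣ ∁ S ∣ (+ m) * Q S)) (λ S → D * Q S))
               (cong₂ _+_ (∑-*ˡ c (λ S → K ∣ S ∣ ∣ ∁ S ∣ (+ m) * Q S)) (∑-*ˡ D Q)) ⟩
    c * ∑[ S ⊆ n ] (K ∣ S ∣ ∣ ∁ S ∣ (+ m) * Q S) + D * ∑ n Q
      ≡⟨ cong₂ (λ x y → c * x + D * y) sphere-energy
               (trans (parseval f) (cong (+ 2 ℕ.^ n *_) (∑-cong (indicator-idem I)))) ⟩
    c * 0ℤ + D * (+ 2 ℕ.^ n * ∑ n f)
      ≡⟨ trans (cong (_+ D * (+ 2 ℕ.^ n * ∑ n f)) (ℤₚ.*-zeroʳ c)) (ℤₚ.+-identityˡ _) ⟩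
    D * (+ 2 ℕ.^ n * ∑ n f) ∎
    where
    open ≡-Reasoning
    Q : Subset n → ℤ
    Q S = fourier f S * fourier f S
    expand : ∀ c k D q → (c * k + D) * q ≡ c * (k * q) + D * q
    expand = solve-∀
    sphere-energy : ∑[ S ⊆ n ] (K ∣ S ∣ ∣ ∁ S ∣ (+ m) * Q S) ≡ 0ℤ
    sphere-energy = begin
      ∑[ S ⊆ n ] (K ∣ S ∣ ∣ ∁ S ∣ (+ m) * Q S)   ≡⟨ ∑-cong (λ S → cong (_* Q S) (sym (fourier-sphere m S))) ⟩
      ∑[ S ⊆ n ] (fourier (sphere m) S * Q S)   ≡⟨ fourier-quadratic-form (sphere m) f ⟩
      + 2 ℕ.^ n * ∑[ A ⊆ n ] ∑[ B ⊆ n ] (f A * f B * sphere m (A △ B))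
        ≡⟨ cong (+ 2 ℕ.^ n *_) (∑-zero (λ A → ∑-zero (sphere-orthogonal A))) ⟩
      + 2 ℕ.^ n * 0ℤ                            ≡⟨ ℤₚ.*-zeroʳ (+ 2 ℕ.^ n) ⟩
      0ℤ                                        ∎

-- Counting in ℤ and ℚ

fromℤ-+ : ∀ x y → fromℤ (x + y) ≡ fromℤ x ℚ.+ fromℤ y
fromℤ-+ x y = ℚₚ.toℚᵘ-injective
  (ℚᵘₚ.≃-trans (ℚᵘ.*≡* (cong (_* 1ℤ) (sym (cong₂ _+_ (ℤₚ.*-identityʳ x) (ℤₚ.*-identityʳ y)))))
               (ℚᵘₚ.≃-sym (ℚₚ.toℚᵘ-homo-+ (fromℤ x) (fromℤ y))))

fromℤ-* : ∀ x y → fromℤ (x * y) ≡ fromℤ x ℚ.* fromℤ y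
fromℤ-* x y = ℚₚ.toℚᵘ-injective (ℚᵘₚ.≃-sym (ℚₚ.toℚᵘ-homo-* (fromℤ x) (fromℤ y)))

fromℤ-neg : ∀ x → fromℤ (- x) ≡ ℚ.- fromℤ x
fromℤ-neg (+ zero)  = refl
fromℤ-neg (+ suc x) = refl
fromℤ-neg -[1+ x ]  = refl

sign≡fromℤ-signℤ : ∀ m → sign m ≡ fromℤ (signℤ m)
sign≡fromℤ-signℤ zero    = refl
sign≡fromℤ-signℤ (suc m) = trans (cong ℚ.-_ (sign≡fromℤ-signℤ m)) (sym (fromℤ-neg (signℤ m)))

sumℤ : List ℤ → ℤ
sumℤ = foldr _+_ 0ℤ

sumℤ-++ : ∀ xs ys → sumℤ (xs ++ ys) ≡ sumℤ xs + sumℤ ys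
sumℤ-++ []       ys = sym (ℤₚ.+-identityˡ (sumℤ ys))
sumℤ-++ (x ∷ xs) ys = trans (cong (_+_ x) (sumℤ-++ xs ys)) (sym (ℤₚ.+-assoc x (sumℤ xs) (sumℤ ys)))

sumℤ-allSubsets : ∀ n (g : Subset n → ℤ) → sumℤ (map g (allSubsets n)) ≡ ∑ n g
sumℤ-allSubsets zero    g = ℤₚ.+-identityʳ (g [])
sumℤ-allSubsets (suc n) g = begin
  sumℤ (map g (map (false ∷_) xs ++ map (true ∷_) xs))
    ≡⟨ cong sumℤ (List.map-++ g (map (false ∷_) xs) (map (true ∷_) xs)) ⟩
  sumℤ (map g (map (false ∷_) xs) ++ map g (map (true ∷_) xs))
    ≡⟨ sumℤ-++ (map g (map (false ∷_) xs)) (map g (map (true ∷_) xs)) ⟩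
  sumℤ (map g (map (false ∷_) xs)) + sumℤ (map g (map (true ∷_) xs))
    ≡⟨ cong₂ _+_ (trans (cong sumℤ (sym (List.map-∘ xs))) (sumℤ-allSubsets n (g ∘ (false ∷_))))
                 (trans (cong sumℤ (sym (List.map-∘ xs))) (sumℤ-allSubsets n (g ∘ (true ∷_)))) ⟩
  ∑ (suc n) g ∎
  where
  open ≡-Reasoning
  xs : List (Subset n)
  xs = allSubsets n

count≡sumℤ : ∀ {A : Set} (I : A → Bool) xs →
             + length (filter (λ a → I a Bool.≟ true) xs) ≡ sumℤ (map (λ a → if I a then 1ℤ else 0ℤ) xs)
count≡sumℤ I []       = refl
count≡sumℤ I (x ∷ xs) with I x
... | true  = cong (_+_ 1ℤ) (count≡sumℤ I xs)
... | false = trans (count≡sumℤ I xs) (sym (ℤₚ.+-identityˡ _))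

size≡∑ : ∀ {n} (I : Subset n → Bool) → + size I ≡ ∑ n (indicator I)
size≡∑ {n} I = trans (count≡sumℤ I (allSubsets n)) (sumℤ-allSubsets n (indicator I))

sumℚ-fromℤ : ∀ {A : Set} (g : A → ℤ) r xs → sumℚ (map (λ a → fromℤ (g a) ℚ.* r) xs) ≡ fromℤ (sumℤ (map g xs)) ℚ.* r
sumℚ-fromℤ g r []       = sym (ℚₚ.*-zeroˡ r)
sumℚ-fromℤ g r (x ∷ xs) = begin
  fromℤ (g x) ℚ.* r ℚ.+ sumℚ (map (λ a → fromℤ (g a) ℚ.* r) xs)  ≡⟨ cong (fromℤ (g x) ℚ.* r ℚ.+_) (sumℚ-fromℤ g r xs) ⟩
  fromℤ (g x) ℚ.* r ℚ.+ fromℤ Σxs ℚ.* r                           ≡⟨ sym (ℚₚ.*-distribʳ-+ r (fromℤ (g x)) (fromℤ Σxs)) ⟩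
  (fromℤ (g x) ℚ.+ fromℤ Σxs) ℚ.* r                               ≡⟨ cong (ℚ._* r) (sym (fromℤ-+ (g x) Σxs)) ⟩
  fromℤ (g x + Σxs) ℚ.* r                                          ∎
  where
  open ≡-Reasoning
  Σxs : ℤ
  Σxs = sumℤ (map g xs)

sumℚ-allSubsets : ∀ {n} (g : Subset n → ℤ) r →
                  sumℚ (map (λ p → fromℤ (g p) ℚ.* r) (allSubsets n)) ≡ fromℤ (∑ n g) ℚ.* r
sumℚ-allSubsets {n} g r = trans (sumℚ-fromℤ g r (allSubsets n)) (cong (λ t → fromℤ t ℚ.* r) (sumℤ-allSubsets n g))

-- Independent sets of Ω_n

∣p∣+∣∁p∣≡n : ∀ {n} (p : Subset n) → ∣ p ∣ ℕ.+ ∣ ∁ p ∣ ≡ n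
∣p∣+∣∁p∣≡n p = trans (cong (∣ p ∣ ℕ.+_) (∣∁p∣≡n∸∣p∣ p)) (ℕₚ.m+[n∸m]≡n (∣p∣≤n p))

module Ω (k : ℕ) where

  -- L is chosen so that suc L reduces to 2 ℕ.* suc k, the radius n/2 of Ω_n in IsIndependent.
  n L M : ℕ
  n = 4 ℕ.* suc k
  L = ℕ.pred (2 ℕ.* suc k)
  M = suc L

  n≡M+M : n ≡ M ℕ.+ M
  n≡M+M = double k
    where
    double : ∀ k → 4 ℕ.* suc k ≡ 2 ℕ.* suc k ℕ.+ 2 ℕ.* suc k
    double = ℕ-solve-∀

  open MiddleBound L (trans (cong (signℤ ∘ (suc k ℕ.+_)) (ℕₚ.+-identityʳ (suc k))) (signℤ-even (suc k)))
    using (c; weight; weight-nonneg)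

  -- The decision procedure hidden in InColSpaceW̃, so that does (isColumn? p) agrees with it definitionally.
  isColumn? : ∀ p → Dec (IsColumn k p)
  isColumn? p = (∣ p ∣ ℕ.≟ 2) ⊎-dec (2 ℕ.+ ∣ p ∣ ℕ.≟ n)

  w : Subset n → ℤ
  w S = weight ∣ S ∣ ∣ ∁ S ∣

  w-nonneg : ∀ S → 0ℤ ≤ w S
  w-nonneg S = proj₁ (weight-nonneg ∣ S ∣ ∣ ∁ S ∣ (trans (∣p∣+∣∁p∣≡n S) n≡M+M))

  w≡0⇒column : ∀ S → w S ≡ 0ℤ → IsColumn k S
  w≡0⇒column S w≡0 with proj₂ (weight-nonneg ∣ S ∣ ∣ ∁ S ∣ (trans (∣p∣+∣∁p∣≡n S) n≡M+M)) w≡0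
  ... | inj₁ ∣S∣≡2  = inj₁ ∣S∣≡2
  ... | inj₂ ∣∁S∣≡2 = inj₂ (trans (ℕₚ.+-comm 2 ∣ S ∣) (trans (cong (∣ S ∣ ℕ.+_) (sym ∣∁S∣≡2)) (∣p∣+∣∁p∣≡n S)))

  ⊥-not-column : ¬ IsColumn k ⊥
  ⊥-not-column (inj₁ ∣⊥∣≡2)   = 0≢2 (trans (sym (∣⊥∣≡0 n)) ∣⊥∣≡2)
    where
    0≢2 : ¬ 0 ≡ 2
    0≢2 ()
  ⊥-not-column (inj₂ 2+∣⊥∣≡n) = ℕₚ.<⇒≢ 2<n (trans (cong (2 ℕ.+_) (sym (∣⊥∣≡0 n))) 2+∣⊥∣≡n)
    where
    2<n : 2 ℕ.< n
    2<n = ℕₚ.≤-trans (s≤s (s≤s (s≤s z≤n))) (ℕₚ.*-monoʳ-≤ 4 (s≤s z≤n))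

  1+c≡n : suc c ≡ n
  1+c≡n = count k
    where
    count : ∀ k → suc (suc ((k ℕ.+ suc (k ℕ.+ 0)) ℕ.+ (k ℕ.+ suc (k ℕ.+ 0)))) ≡ 4 ℕ.* suc k
    count = ℕ-solve-∀

  D : ℤ
  D = K 0 (M ℕ.+ M) (+ M)

  w-⊥ : w ⊥ ≡ + suc c * D
  w-⊥ = trans (cong₂ weight (∣⊥∣≡0 n) ∣∁⊥∣≡M+M) (collect (+ c) D)
    where
    ∣∁⊥∣≡M+M : ∣ ∁ (⊥ {n}) ∣ ≡ M ℕ.+ M
    ∣∁⊥∣≡M+M = trans (∣∁p∣≡n∸∣p∣ (⊥ {n})) (trans (cong (n ℕ.∸_) (∣⊥∣≡0 n)) n≡M+M)
    collect : ∀ c d → c * d + d ≡ (1ℤ + c) * d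
    collect = solve-∀

  module _ (I : Subset n → Bool) (independent : IsIndependent k I) where

    private
      f : Subset n → ℤ
      f = indicator I
      Q : Subset n → ℤ
      Q S = fourier f S * fourier f S

    rest : ℤ
    rest = ∑[ S ⊆ n ] (if does (S ≟ₛ ⊥) then 0ℤ else w S * Q S)

    rest-term-nonneg : ∀ S → 0ℤ ≤ (if does (S ≟ₛ ⊥) then 0ℤ else w S * Q S)
    rest-term-nonneg S with does (S ≟ₛ ⊥)
    ... | true  = +≤+ z≤n
    ... | false = *-nonneg (w-nonneg S) (square-nonneg (fourier f S))

    energy : + suc c * D * (+ size I * + size I) + rest ≡ D * (+ 2 ℕ.^ n * + size I)
    energy = begin
      + suc c * D * (+ size I * + size I) + rest  ≡⟨ cong₂ (λ x s → x * (s * s) + rest) (sym w-⊥) (size≡∑ I) ⟩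
      w ⊥ * (∑ n f * ∑ n f) + rest             ≡⟨ cong (λ s → w ⊥ * (s * s) + rest) (sym (fourier-⊥ f)) ⟩
      w ⊥ * Q ⊥ + rest                         ≡⟨ sym (∑-split-⊥ (λ S → w S * Q S)) ⟩
      ∑[ S ⊆ n ] (w S * Q S)                   ≡⟨ weighted-energy M I independent (+ c) D ⟩
      D * (+ 2 ℕ.^ n * ∑ n f)                  ≡⟨ cong (λ s → D * (+ 2 ℕ.^ n * s)) (sym (size≡∑ I)) ⟩
      D * (+ 2 ℕ.^ n * + size I)               ∎
      where open ≡-Reasoning

    size-bound : size I ℕ.* n ℕ.≤ 2 ℕ.^ n × (size I ℕ.* n ≡ 2 ℕ.^ n → rest ≡ 0ℤ)
    size-bound = subst (λ N → size I ℕ.* N ℕ.≤ 2 ℕ.^ n × (size I ℕ.* N ≡ 2 ℕ.^ n → rest ≡ 0ℤ)) 1+c≡n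
                       (cancel-bound (suc c) (2 ℕ.^ n) (size I) (K-zeroˡ-pos (M ℕ.+ M) M (ℕₚ.m≤n+m M M))
                                     (∑-nonneg rest-term-nonneg) energy)

    fourier-support : rest ≡ 0ℤ → ∀ S → ¬ S ≡ ⊥ → ¬ IsColumn k S → fourier f S ≡ 0ℤ
    fourier-support rest≡0 S S≢⊥ ¬column with ℤₚ.i*j≡0⇒i≡0∨j≡0 (w S) wQ≡0
      where
      wQ≡0 : w S * Q S ≡ 0ℤ
      wQ≡0 = trans (cong (λ b → if b then 0ℤ else w S * Q S) (sym (dec-false (S ≟ₛ ⊥) S≢⊥)))
                   (∑-nonneg-≡0 rest-term-nonneg rest≡0 S)
    ... | inj₁ w≡0 = ⊥-elim (¬column (w≡0⇒column S w≡0))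
    ... | inj₂ Q≡0 = Sum.[ id , id ] (ℤₚ.i*j≡0⇒i≡0∨j≡0 (fourier f S) Q≡0)

    column-expansion : rest ≡ 0ℤ → ∀ A →
      + 2 ℕ.^ n * f A ≡ ∑[ S ⊆ n ] (if does (isColumn? S) then fourier f S * walsh A S else 0ℤ) + ∑ n f
    column-expansion rest≡0 A = begin
      + 2 ℕ.^ n * f A
        ≡⟨ sym (fourier-inversion f A) ⟩
      ∑[ S ⊆ n ] (fourier f S * walsh A S)
        ≡⟨ ∑-split-⊥ (λ S → fourier f S * walsh A S) ⟩
      fourier f ⊥ * walsh A ⊥ + ∑[ S ⊆ n ] (if does (S ≟ₛ ⊥) then 0ℤ else fourier f S * walsh A S)
        ≡⟨ cong₂ _+_ (trans (cong₂ _*_ (fourier-⊥ f) (walsh-⊥ A)) (ℤₚ.*-identityʳ (∑ n f)))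
                     (∑-cong off-⊥≡on-column) ⟩
      ∑ n f + ∑[ S ⊆ n ] (if does (isColumn? S) then fourier f S * walsh A S else 0ℤ)
        ≡⟨ ℤₚ.+-comm (∑ n f) _ ⟩
      ∑[ S ⊆ n ] (if does (isColumn? S) then fourier f S * walsh A S else 0ℤ) + ∑ n f ∎
      where
      open ≡-Reasoning
      on-column : ∀ {P : Set} (P? : Dec P) x → (¬ P → x ≡ 0ℤ) → x ≡ (if does P? then x else 0ℤ)
      on-column (yes _) x _    = refl
      on-column (no ¬p) x x≡0 = x≡0 ¬p
      off-⊥≡on-column : ∀ S → (if does (S ≟ₛ ⊥) then 0ℤ else fourier f S * walsh A S)
                              ≡ (if does (isColumn? S) then fourier f S * walsh A S else 0ℤ)
      off-⊥≡on-column S with S ≟ₛ ⊥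
      ... | yes refl =
        sym (cong (λ b → if b then fourier f ⊥ * walsh A ⊥ else 0ℤ) (dec-false (isColumn? ⊥) ⊥-not-column))
      ... | no S≢⊥   = on-column (isColumn? S) (fourier f S * walsh A S) λ ¬column →
        trans (cong (_* walsh A S) (fourier-support rest≡0 S S≢⊥ ¬column)) (ℤₚ.*-zeroˡ (walsh A S))

    in-column-space : rest ≡ 0ℤ → InColSpaceW̃ k (χ I)
    in-column-space rest≡0 = coefficient , fromℤ (∑ n f) ℚ.* r , λ A → sym (expansion A)
      where
      instance
        2ⁿ≢0 : ℕ.NonZero (2 ℕ.^ n)
        2ⁿ≢0 = ℕₚ.m^n≢0 2 n
      r : ℚ.ℚ
      r = ℚ.1/ fromℤ (+ 2 ℕ.^ n)
      coefficient : Subset n → ℚ.ℚ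
      coefficient p = fromℤ (fourier f p) ℚ.* r
      column-term : ∀ b x m → (if b then fromℤ x ℚ.* r ℚ.* sign m else 0ℚ)
                              ≡ fromℤ (if b then x * signℤ m else 0ℤ) ℚ.* r
      column-term false x m = sym (ℚₚ.*-zeroˡ r)
      column-term true  x m = begin
        fromℤ x ℚ.* r ℚ.* sign m                 ≡⟨ cong (fromℤ x ℚ.* r ℚ.*_) (sign≡fromℤ-signℤ m) ⟩
        fromℤ x ℚ.* r ℚ.* fromℤ (signℤ m)        ≡⟨ ℚₚ.*-assoc (fromℤ x) r (fromℤ (signℤ m)) ⟩
        fromℤ x ℚ.* (r ℚ.* fromℤ (signℤ m))      ≡⟨ cong (fromℤ x ℚ.*_) (ℚₚ.*-comm r (fromℤ (signℤ m))) ⟩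
        fromℤ x ℚ.* (fromℤ (signℤ m) ℚ.* r)      ≡⟨ sym (ℚₚ.*-assoc (fromℤ x) (fromℤ (signℤ m)) r) ⟩
        fromℤ x ℚ.* fromℤ (signℤ m) ℚ.* r        ≡⟨ cong (ℚ._* r) (sym (fromℤ-* x (signℤ m))) ⟩
        fromℤ (x * signℤ m) ℚ.* r                ∎
        where open ≡-Reasoning
      expansion : ∀ A → sumℚ (map (λ p → if does (isColumn? p) then coefficient p ℚ.* sign ∣ A ∩ p ∣ else 0ℚ)
                                  (allSubsets n))
                        ℚ.+ fromℤ (∑ n f) ℚ.* r ≡ χ I A
      expansion A = begin
        sumℚ (map (λ p → if does (isColumn? p) then coefficient p ℚ.* sign ∣ A ∩ p ∣ else 0ℚ) (allSubsets n)) ℚ.+ c₀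
          ≡⟨ cong (λ xs → sumℚ xs ℚ.+ c₀)
                  (List.map-cong (λ p → column-term (does (isColumn? p)) (fourier f p) ∣ A ∩ p ∣) (allSubsets n)) ⟩
        sumℚ (map (λ p → fromℤ (g p) ℚ.* r) (allSubsets n)) ℚ.+ c₀
          ≡⟨ cong (ℚ._+ c₀) (sumℚ-allSubsets g r) ⟩
        fromℤ (∑ n g) ℚ.* r ℚ.+ fromℤ (∑ n f) ℚ.* r
          ≡⟨ sym (ℚₚ.*-distribʳ-+ r (fromℤ (∑ n g)) (fromℤ (∑ n f))) ⟩
        (fromℤ (∑ n g) ℚ.+ fromℤ (∑ n f)) ℚ.* r
          ≡⟨ cong (ℚ._* r) (sym (fromℤ-+ (∑ n g) (∑ n f))) ⟩
        fromℤ (∑ n g + ∑ n f) ℚ.* r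
          ≡⟨ cong (λ t → fromℤ t ℚ.* r) (sym (column-expansion rest≡0 A)) ⟩
        fromℤ (+ 2 ℕ.^ n * f A) ℚ.* r
          ≡⟨ cong (ℚ._* r) (trans (fromℤ-* (+ 2 ℕ.^ n) (f A)) (ℚₚ.*-comm (fromℤ (+ 2 ℕ.^ n)) (fromℤ (f A)))) ⟩
        fromℤ (f A) ℚ.* fromℤ (+ 2 ℕ.^ n) ℚ.* r
          ≡⟨ ℚₚ.*-assoc (fromℤ (f A)) (fromℤ (+ 2 ℕ.^ n)) r ⟩
        fromℤ (f A) ℚ.* (fromℤ (+ 2 ℕ.^ n) ℚ.* r)
          ≡⟨ cong (fromℤ (f A) ℚ.*_) (ℚₚ.*-inverseʳ (fromℤ (+ 2 ℕ.^ n))) ⟩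
        fromℤ (f A) ℚ.* 1ℚ
          ≡⟨ ℚₚ.*-identityʳ (fromℤ (f A)) ⟩
        fromℤ (f A)
          ≡⟨ fromℤ-indicator (I A) ⟩
        χ I A ∎
        where
        open ≡-Reasoning
        c₀ : ℚ.ℚ
        c₀ = fromℤ (∑ n f) ℚ.* r
        g : Subset n → ℤ
        g p = if does (isColumn? p) then fourier f p * walsh A p else 0ℤ
        fromℤ-indicator : ∀ b → fromℤ (if b then 1ℤ else 0ℤ) ≡ (if b then 1ℚ else 0ℚ)
        fromℤ-indicator true  = refl
        fromℤ-indicator false = refl

mainTheorem2 : (k : ℕ) →
    ((I : Subset (4 ℕ.* suc k) → Bool) → IsIndependent k I → size I ℕ.* (4 ℕ.* suc k) ℕ.≤ 2 ℕ.^ (4 ℕ.* suc k))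
    × ((I : Subset (4 ℕ.* suc k) → Bool) → IsIndependent k I → size I ℕ.* (4 ℕ.* suc k) ≡ 2 ℕ.^ (4 ℕ.* suc k)
        → InColSpaceW̃ k (χ I))
mainTheorem2 k =
    (λ I independent → proj₁ (size-bound I independent))
  , (λ I independent extremal → in-column-space I independent (proj₂ (size-bound I independent) extremal))
  where open Ω k
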